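{- Let $\mathbf A$ be a finite Heyting algebra that is zero-projective in the variety of Heyting algebras. Then $\mathbf A$ has at most two atoms.
   Context: Heyting algebras are bounded commutative integral residuated lattices $\langle A,\vee,\wedge,\cdot,\rightarrow,0,1\rangle$ satisfying $xy\approx x\wedge y$. An atom is an element covering $0$. $\mathbf A$ is zero-projective in a class $\mathcal K$ if for all $\mathbf B,\mathbf C\in\mathcal K$, every homomorphism $h:\mathbf A\to\mathbf C$ and every surjective homomorphism $g:\mathbf B\to\mathbf C$ with $g^{ -1}(0)=\{0\}$, there is a homomorphism $f:\mathbf A\to\mathbf B$ with $h=gf$. -}

module Defs where

open import Level using (Level; _⊔_)
open import Data.Nat using (ℕ)
open import Data.Fin using (Fin)
open import Data.Product using (Σ; ∃; _×_)
open import Data.Sum using (_⊎_)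
open import Relation.Nullary using (¬_)
open import Relation.Binary.Lattice.Bundles using (HeytingAlgebra)

-- Homomorphism of Heyting algebras: a map respecting the equality and
-- preserving ∨, ∧, ⇨ (= residual; · = ∧ in a Heyting algebra), ⊥ (= 0), ⊤ (= 1).
record IsHAHom {a₁ a₂ a₃ b₁ b₂ b₃ : Level}
               (A : HeytingAlgebra a₁ a₂ a₃) (B : HeytingAlgebra b₁ b₂ b₃)
               (f : HeytingAlgebra.Carrier A → HeytingAlgebra.Carrier B)
               : Set (a₁ ⊔ a₂ ⊔ b₂) where
  module A = HeytingAlgebra A
  module B = HeytingAlgebra B
  field
    cong     : ∀ {x y} → x A.≈ y → f x B.≈ f y
    pres-∨   : ∀ x y → f (x A.∨ y) B.≈ (f x B.∨ f y)
    pres-∧   : ∀ x y → f (x A.∧ y) B.≈ (f x B.∧ f y)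
    pres-⇨   : ∀ x y → f (x A.⇨ y) B.≈ (f x B.⇨ f y)
    pres-⊥   : f A.⊥ B.≈ B.⊥
    pres-⊤   : f A.⊤ B.≈ B.⊤

HAHom : {a₁ a₂ a₃ b₁ b₂ b₃ : Level} →
        HeytingAlgebra a₁ a₂ a₃ → HeytingAlgebra b₁ b₂ b₃ → Set _
HAHom A B = Σ (HeytingAlgebra.Carrier A → HeytingAlgebra.Carrier B) (IsHAHom A B)

Finite : {c ℓ₁ ℓ₂ : Level} → HeytingAlgebra c ℓ₁ ℓ₂ → Set _
Finite A = ∃ λ (n : ℕ) → Σ (Fin n → Carrier) λ e → ∀ x → ∃ λ i → e i ≈ x
  where open HeytingAlgebra A

IsAtom : {c ℓ₁ ℓ₂ : Level} (A : HeytingAlgebra c ℓ₁ ℓ₂) → HeytingAlgebra.Carrier A → Set _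
IsAtom A a = (¬ (a ≈ ⊥)) × (∀ x → x ≤ a → (x ≈ ⊥) ⊎ (x ≈ a))
  where open HeytingAlgebra A

AtMostTwoAtoms : {c ℓ₁ ℓ₂ : Level} → HeytingAlgebra c ℓ₁ ℓ₂ → Set _
AtMostTwoAtoms A = ∀ a b d → IsAtom A a → IsAtom A b → IsAtom A d →
                   (a ≈ b) ⊎ (a ≈ d) ⊎ (b ≈ d)
  where open HeytingAlgebra A

-- Zero-projectivity of A in the variety of Heyting algebras, where B, C
-- range over Heyting algebras at the given universe levels.
ZeroProjective : {a₁ a₂ a₃ : Level} (c ℓ₁ ℓ₂ : Level) →
                 HeytingAlgebra a₁ a₂ a₃ → Set _
ZeroProjective c ℓ₁ ℓ₂ A =
  (B C : HeytingAlgebra c ℓ₁ ℓ₂) (h : HAHom A C) (g : HAHom B C) →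
  (∀ z → ∃ λ y → HeytingAlgebra._≈_ C (Σ.proj₁ g y) z) →
  (∀ y → HeytingAlgebra._≈_ C (Σ.proj₁ g y) (HeytingAlgebra.⊥ C) →
         HeytingAlgebra._≈_ B y (HeytingAlgebra.⊥ B)) →
  ∃ λ (f : HAHom A B) →
    ∀ x → HeytingAlgebra._≈_ C (Σ.proj₁ h x) (Σ.proj₁ g (Σ.proj₁ f x))

module Submission where

-- For a filter D of A, the pairs (x , ε) ∈ A × Bool with ε = true only if x ∈ D form a Heyting
-- algebra whose projection onto A is surjective and reflects 0. Zero-projectivity splits this
-- projection, and the Boolean coordinate of a splitting is a prime filter R ⊆ D that also contains
-- every x ⇨ y ∈ D with x ∉ R. Three distinct atoms give three pairwise incomparable prime filters.
-- Replacing them by such prime subfilters of their pairwise intersections gives again a pairwise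
-- incomparable triple, whose first member is strictly smaller than the old one: an infinite
-- descent, impossible in a finite algebra.

open import Defs
open import Level using (_⊔_)
open import Data.Bool using (Bool; true; false; not; T) renaming (_∧_ to _&&_; _∨_ to _||_)
open import Data.Bool.Properties using (T-≡; T-∧; T-∨)
open import Data.Empty using (⊥-elim)
open import Data.Fin using (Fin)
open import Data.Fin.Properties using (any?)
import Data.Fin.Subset as Subset
open import Data.Fin.Subset.Properties using (p⊂q⇒∣p∣<∣q∣)
open import Data.Nat using (ℕ; _<_)
open import Data.Nat.Induction using (<-wellFounded)
open import Data.Product using (∃; _×_; _,_; proj₁; proj₂)
open import Data.Sum using (_⊎_; inj₁; inj₂; [_,_]′; map)
open import Data.Vec using (tabulate)
open import Data.Vec.Properties using (lookup⇒[]=; []=⇒lookup; lookup∘tabulate)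
open import Function using (_∘_; Equivalence)
open import Induction.WellFounded using (Acc; acc)
open import Relation.Binary.Core using (Rel)
open import Relation.Binary.Definitions using (_Respects_)
open import Relation.Binary.Lattice.Bundles using (HeytingAlgebra)
open import Relation.Binary.PropositionalEquality using (_≡_; refl; sym; trans; subst)
open import Relation.Nullary using (¬_; Dec; yes; no)
open import Relation.Nullary.Decidable
  using (isYes; toWitness; fromWitness; decidable-stable; T?; ¬?; _×-dec_)

open Equivalence using (to; from)

module _ {n : ℕ} {f : Fin n → Bool} {i : Fin n} where

  ∈-tabulate⁺ : T (f i) → i Subset.∈ tabulate f
  ∈-tabulate⁺ fi = lookup⇒[]= i (tabulate f) (trans (lookup∘tabulate f i) (to T-≡ fi))

  ∈-tabulate⁻ : i Subset.∈ tabulate f → T (f i)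
  ∈-tabulate⁻ i∈f = from T-≡ (trans (sym (lookup∘tabulate f i)) ([]=⇒lookup i∈f))

∣tabulate∣-< : ∀ {n} {f g : Fin n → Bool} → (∀ {i} → T (f i) → T (g i)) →
               ∀ j → T (g j) → ¬ T (f j) → Subset.∣ tabulate f ∣ < Subset.∣ tabulate g ∣
∣tabulate∣-< f⊆g j gⱼ ¬fⱼ =
  p⊂q⇒∣p∣<∣q∣ ( (λ i∈f → ∈-tabulate⁺ (f⊆g (∈-tabulate⁻ i∈f)))
              , j , ∈-tabulate⁺ gⱼ , ¬fⱼ ∘ ∈-tabulate⁻ )

T-antisym : ∀ {p q} → (T p → T q) → (T q → T p) → p ≡ q
T-antisym {false} {false} _   _   = refl
T-antisym {false} {true}  _   q⇒p = ⊥-elim (q⇒p _)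
T-antisym {true}  {false} p⇒q _   = ⊥-elim (p⇒q _)
T-antisym {true}  {true}  _   _   = refl

T-residual⁺ : ∀ {w x y} → (T (w && x) → T y) → T w → T (not x || y)
T-residual⁺ {true} {false} _   _ = _
T-residual⁺ {true} {true}  w∧x⇒y _ = w∧x⇒y _

T-residual⁻ : ∀ {w x y} → (T w → T (not x || y)) → T (w && x) → T y
T-residual⁻ {true} {true} w⇒¬x∨y _ = w⇒¬x∨y _

module _ {a₁ a₂ a₃ b₁ b₂ b₃} {A : HeytingAlgebra a₁ a₂ a₃} {B : HeytingAlgebra b₁ b₂ b₃}
         {f : HeytingAlgebra.Carrier A → HeytingAlgebra.Carrier B} (f-hom : IsHAHom A B f) where
  open IsHAHom f-hom

  IsHAHom-monotone : ∀ {x y} → x A.≤ y → f x B.≤ f y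
  IsHAHom-monotone {x} {y} x≤y =
    B.trans (B.reflexive (B.Eq.trans (cong x≈x∧y) (pres-∧ x y))) (B.x∧y≤y _ _)
    where
    x≈x∧y : x A.≈ x A.∧ y
    x≈x∧y = A.antisym (A.∧-greatest A.refl x≤y) (A.x∧y≤x x y)

module _ {c ℓ₁ ℓ₂} (A : HeytingAlgebra c ℓ₁ ℓ₂) where
  open HeytingAlgebra A renaming (refl to ≤-refl; trans to ≤-trans)
  open import Relation.Binary.Lattice.Properties.HeytingAlgebra A
    using (⇨-eval; y≤x⇨y; ⇨-cong; ∧-distribˡ-∨-≤)
  open import Relation.Binary.Reasoning.PartialOrder poset

  private
    variable
      x y : Carrier
      K L M : Carrier → Bool

  idHAHom : HAHom A A
  idHAHom = (λ x → x) , record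
    { cong = λ x≈y → x≈y ; pres-∨ = λ _ _ → Eq.refl ; pres-∧ = λ _ _ → Eq.refl
    ; pres-⇨ = λ _ _ → Eq.refl ; pres-⊥ = Eq.refl ; pres-⊤ = Eq.refl }

  infix 4 _∈_ _∉_ _⊆_ _⊈_
  infixr 7 _∩_

  _∈_ _∉_ : Carrier → (Carrier → Bool) → Set
  x ∈ K = T (K x)
  x ∉ K = ¬ x ∈ K

  _⊆_ _⊈_ Incomparable : (Carrier → Bool) → (Carrier → Bool) → Set c
  K ⊆ L = ∀ {x} → x ∈ K → x ∈ L
  K ⊈ L = ∃ λ x → x ∈ K × x ∉ L
  Incomparable K L = K ⊈ L × L ⊈ K

  _∩_ : (Carrier → Bool) → (Carrier → Bool) → Carrier → Bool
  (K ∩ L) x = K x && L x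

  ∩-⊆ˡ : K ∩ L ⊆ K
  ∩-⊆ˡ = proj₁ ∘ to T-∧

  ∩-⊆ʳ : K ∩ L ⊆ L
  ∩-⊆ʳ {K} {x = x} = proj₂ ∘ to (T-∧ {K x})

  ⊈-⊆ʳ : K ⊈ L → M ⊆ L → K ⊈ M
  ⊈-⊆ʳ (x , x∈K , x∉L) M⊆L = x , x∈K , x∉L ∘ M⊆L

  ⊆⇒¬⊈ : K ⊆ L → ¬ K ⊈ L
  ⊆⇒¬⊈ K⊆L (_ , x∈K , x∉L) = x∉L (K⊆L x∈K)

  module _ (finite : Finite A) where
    private
      e : Fin (proj₁ finite) → Carrier
      e = proj₁ (proj₂ finite)
      enum : ∀ x → ∃ λ i → e i ≈ x
      enum = proj₂ (proj₂ finite)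

    ⊆-or-⊈ : (_∈ K) Respects _≈_ → (_∈ L) Respects _≈_ → K ⊆ L ⊎ K ⊈ L
    ⊆-or-⊈ {K} {L} K-resp L-resp with any? (λ i → T? (K (e i)) ×-dec ¬? (T? (L (e i))))
    ... | yes (i , eᵢ∈K , eᵢ∉L) = inj₂ (e i , eᵢ∈K , eᵢ∉L)
    ... | no ∄ = inj₁ λ {x} x∈K → let i , eᵢ≈x = enum x in
      L-resp eᵢ≈x (decidable-stable (T? (L (e i))) λ eᵢ∉L → ∄ (i , K-resp (Eq.sym eᵢ≈x) x∈K , eᵢ∉L))

    size : (Carrier → Bool) → ℕ
    size K = Subset.∣ tabulate (K ∘ e) ∣

    ⊂⇒size< : (_∈ K) Respects _≈_ → (_∈ L) Respects _≈_ → K ⊆ L → L ⊈ K → size K < size L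
    ⊂⇒size< K-resp L-resp K⊆L (x , x∈L , x∉K) = let i , eᵢ≈x = enum x in
      ∣tabulate∣-< K⊆L i (L-resp (Eq.sym eᵢ≈x) x∈L) (x∉K ∘ K-resp eᵢ≈x)

  record IsFilter (F : Carrier → Bool) : Set (c ⊔ ℓ₂) where
    field
      ∈-mono   : ∀ {x y} → x ≤ y → x ∈ F → y ∈ F
      ∧-closed : ∀ {x y} → x ∈ F → y ∈ F → x ∧ y ∈ F
      ⊤∈       : ⊤ ∈ F
      ⊥∉       : ⊥ ∉ F

    ∈-resp-≈ : (_∈ F) Respects _≈_
    ∈-resp-≈ x≈y = ∈-mono (reflexive x≈y)

  record IsPrimeFilter (F : Carrier → Bool) : Set (c ⊔ ℓ₂) where
    field
      isFilter : IsFilter F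
      ∨-prime  : ∀ {x y} → x ∨ y ∈ F → x ∈ F ⊎ y ∈ F

    open IsFilter isFilter public

  ∩-isFilter : IsFilter K → IsFilter L → IsFilter (K ∩ L)
  ∩-isFilter {K} {L} K-filter L-filter = record
    { ∈-mono   = λ x≤y x∈K∩L → both (K.∈-mono x≤y (left x∈K∩L)) (L.∈-mono x≤y (right x∈K∩L))
    ; ∧-closed = λ x∈K∩L y∈K∩L → both (K.∧-closed (left x∈K∩L) (left y∈K∩L))
                                      (L.∧-closed (right x∈K∩L) (right y∈K∩L))
    ; ⊤∈       = both K.⊤∈ L.⊤∈
    ; ⊥∉       = K.⊥∉ ∘ left
    }
    where
    module K = IsFilter K-filter
    module L = IsFilter L-filter
    left : x ∈ K ∩ L → x ∈ K
    left = ∩-⊆ˡ {K} {L}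
    right : x ∈ K ∩ L → x ∈ L
    right = ∩-⊆ʳ {K} {L}
    both : x ∈ K → x ∈ L → x ∈ K ∩ L
    both x∈K x∈L = from T-∧ (x∈K , x∈L)

  module _ {a} (a-atom : IsAtom A a) where

    atom-≰⊥ : ¬ a ≤ ⊥
    atom-≰⊥ a≤⊥ = proj₁ a-atom (antisym a≤⊥ (minimum a))

    atom-disjoint-or-≤ : ∀ x → a ∧ x ≈ ⊥ ⊎ a ≤ x
    atom-disjoint-or-≤ x with proj₂ a-atom (a ∧ x) (x∧y≤x a x)
    ... | inj₁ a∧x≈⊥ = inj₁ a∧x≈⊥
    ... | inj₂ a∧x≈a = inj₂ (≤-trans (reflexive (Eq.sym a∧x≈a)) (x∧y≤y a x))

    atom-≤? : ∀ x → Dec (a ≤ x)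
    atom-≤? x with atom-disjoint-or-≤ x
    ... | inj₂ a≤x   = yes a≤x
    ... | inj₁ a∧x≈⊥ = no λ a≤x → atom-≰⊥ (≤-trans (∧-greatest ≤-refl a≤x) (reflexive a∧x≈⊥))

    atom-∨-prime : a ≤ x ∨ y → a ≤ x ⊎ a ≤ y
    atom-∨-prime {x} {y} a≤x∨y with atom-disjoint-or-≤ x | atom-disjoint-or-≤ y
    ... | inj₂ a≤x   | _          = inj₁ a≤x
    ... | inj₁ _     | inj₂ a≤y   = inj₂ a≤y
    ... | inj₁ a∧x≈⊥ | inj₁ a∧y≈⊥ = ⊥-elim (atom-≰⊥ (begin
      a                 ≤⟨ ∧-greatest ≤-refl a≤x∨y ⟩
      a ∧ (x ∨ y)       ≤⟨ ∧-distribˡ-∨-≤ a x y ⟩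
      a ∧ x ∨ a ∧ y     ≤⟨ ∨-least (reflexive a∧x≈⊥) (reflexive a∧y≈⊥) ⟩
      ⊥                 ∎))

    ↑ : Carrier → Bool
    ↑ x = isYes (atom-≤? x)

    ↑-isPrimeFilter : IsPrimeFilter ↑
    ↑-isPrimeFilter = record
      { isFilter = record
        { ∈-mono   = λ x≤y a≤x → fromWitness (≤-trans (toWitness a≤x) x≤y)
        ; ∧-closed = λ a≤x a≤y → fromWitness (∧-greatest (toWitness a≤x) (toWitness a≤y))
        ; ⊤∈       = fromWitness (maximum a)
        ; ⊥∉       = atom-≰⊥ ∘ toWitness
        }
      ; ∨-prime = λ a≤x∨y → map fromWitness fromWitness (atom-∨-prime (toWitness a≤x∨y))
      }

  atom-≤-atom : ∀ {a b} → IsAtom A a → IsAtom A b → a ≤ b → a ≈ b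
  atom-≤-atom a-atom b-atom a≤b with proj₂ b-atom _ a≤b
  ... | inj₁ a≈⊥ = ⊥-elim (proj₁ a-atom a≈⊥)
  ... | inj₂ a≈b = a≈b

  atoms-equal-or-incomparable : ∀ {a b} (a-atom : IsAtom A a) (b-atom : IsAtom A b) →
                                a ≈ b ⊎ Incomparable (↑ a-atom) (↑ b-atom)
  atoms-equal-or-incomparable {a} {b} a-atom b-atom with atom-≤? a-atom b
  ... | yes a≤b = inj₁ (atom-≤-atom a-atom b-atom a≤b)
  ... | no  a≰b = inj₂ ( (a , fromWitness ≤-refl , b≰a ∘ toWitness)
                       , (b , fromWitness ≤-refl , a≰b ∘ toWitness))
    where
    b≰a : ¬ b ≤ a
    b≰a b≤a = a≰b (reflexive (Eq.sym (atom-≤-atom b-atom a-atom b≤a)))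

  module _ {D : Carrier → Bool} (D-filter : IsFilter D) where
    open IsFilter D-filter

    record Marked : Set c where
      constructor marked
      field
        elt     : Carrier
        mark    : Bool
        mark⇒∈D : T mark → elt ∈ D

    open Marked

    _≈ₘ_ : Rel Marked ℓ₁
    u ≈ₘ v = elt u ≈ elt v × mark u ≡ mark v

    _≤ₘ_ : Rel Marked ℓ₂
    u ≤ₘ v = elt u ≤ elt v × (T (mark u) → T (mark v))

    _∨ₘ_ _∧ₘ_ _⇨ₘ_ : Marked → Marked → Marked
    u ∨ₘ v = marked (elt u ∨ elt v) (mark u || mark v)
      ([ ∈-mono (x≤x∨y _ _) ∘ mark⇒∈D u , ∈-mono (y≤x∨y _ _) ∘ mark⇒∈D v ]′ ∘ to (T-∨ {mark u}))
    u ∧ₘ v = marked (elt u ∧ elt v) (mark u && mark v)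
      λ m → let mu , mv = to (T-∧ {mark u}) m in ∧-closed (mark⇒∈D u mu) (mark⇒∈D v mv)
    -- the largest mark compatible with Boolean implication and with the invariant mark⇒∈D
    u ⇨ₘ v = marked (elt u ⇨ elt v) ((not (mark u) || mark v) && D (elt u ⇨ elt v))
      (proj₂ ∘ to (T-∧ {not (mark u) || mark v}))

    ⊤ₘ ⊥ₘ : Marked
    ⊤ₘ = marked ⊤ true (λ _ → ⊤∈)
    ⊥ₘ = marked ⊥ false λ ()

    markedAlgebra : HeytingAlgebra c ℓ₁ ℓ₂
    markedAlgebra = record
      { _≈_ = _≈ₘ_ ; _≤_ = _≤ₘ_ ; _∨_ = _∨ₘ_ ; _∧_ = _∧ₘ_ ; _⇨_ = _⇨ₘ_ ; ⊤ = ⊤ₘ ; ⊥ = ⊥ₘ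
      ; isHeytingAlgebra = record
        { isBoundedLattice = record
          { isLattice = record
            { isPartialOrder = record
              { isPreorder = record
                { isEquivalence = record
                  { refl  = Eq.refl , refl
                  ; sym   = λ (p , q) → Eq.sym p , sym q
                  ; trans = λ (p , q) (p′ , q′) → Eq.trans p p′ , trans q q′ }
                ; reflexive = λ (p , q) → reflexive p , subst T q
                ; trans     = λ (p , q) (p′ , q′) → ≤-trans p p′ , q′ ∘ q }
              ; antisym = λ (p , q) (p′ , q′) → antisym p p′ , T-antisym q q′ }
            ; supremum = λ u v →
                  (x≤x∨y _ _ , from T-∨ ∘ inj₁)
                , (y≤x∨y _ _ , from (T-∨ {mark u}) ∘ inj₂)
                , λ _ (p , q) (p′ , q′) → ∨-least p p′ , [ q , q′ ]′ ∘ to (T-∨ {mark u})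
            ; infimum = λ u v →
                  (x∧y≤x _ _ , proj₁ ∘ to T-∧)
                , (x∧y≤y _ _ , proj₂ ∘ to (T-∧ {mark u}))
                , λ _ (p , q) (p′ , q′) → ∧-greatest p p′ , λ m → from T-∧ (q m , q′ m) }
          ; maximum = λ u → maximum (elt u) , _
          ; minimum = λ u → minimum (elt u) , λ () }
        ; exponential = λ w u v →
            (λ (p , q) → transpose-⇨ p
                       , λ m → from T-∧ (T-residual⁺ q m , ∈-mono (transpose-⇨ p) (mark⇒∈D w m)))
          , (λ (p , q) → transpose-∧ p , T-residual⁻ (proj₁ ∘ to T-∧ ∘ q)) } }

    unmark : HAHom markedAlgebra A
    unmark = elt , record
      { cong = proj₁ ; pres-∨ = λ _ _ → Eq.refl ; pres-∧ = λ _ _ → Eq.refl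
      ; pres-⇨ = λ _ _ → Eq.refl ; pres-⊥ = Eq.refl ; pres-⊤ = Eq.refl }

    unmark-surjective : ∀ x → ∃ λ u → elt u ≈ x
    unmark-surjective x = marked x false (λ ()) , Eq.refl

    unmark-reflects-⊥ : ∀ u → elt u ≈ ⊥ → u ≈ₘ ⊥ₘ
    unmark-reflects-⊥ (marked _ false _)   x≈⊥ = x≈⊥ , refl
    unmark-reflects-⊥ (marked _ true  x∈D) x≈⊥ = ⊥-elim (⊥∉ (∈-resp-≈ x≈⊥ (x∈D _)))

  record PrimeSubfilter (D : Carrier → Bool) : Set (c ⊔ ℓ₂) where
    field
      R             : Carrier → Bool
      isPrimeFilter : IsPrimeFilter R
      ⊆D            : R ⊆ D
      ⇨-closed      : ∀ {x y} → x ∉ R → x ⇨ y ∈ D → x ⇨ y ∈ R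

    open IsPrimeFilter isPrimeFilter public

  module _ (zero-projective : ZeroProjective c ℓ₁ ℓ₂ A) where

    primeSubfilter : ∀ {D} → IsFilter D → PrimeSubfilter D
    primeSubfilter {D} D-filter = record
      { R             = R
      ; isPrimeFilter = record
        { isFilter = record
          { ∈-mono   = λ x≤y → proj₂ (IsHAHom-monotone f-hom x≤y)
          ; ∧-closed = λ {x} {y} x∈R y∈R → subst T (sym (proj₂ (pres-∧ x y))) (from T-∧ (x∈R , y∈R))
          ; ⊤∈       = subst T (sym (proj₂ pres-⊤)) _
          ; ⊥∉       = subst T (proj₂ pres-⊥)
          }
        ; ∨-prime = λ {x} {y} → to T-∨ ∘ subst T (proj₂ (pres-∨ x y))
        }
      ; ⊆D       = λ {x} x∈R → ∈-resp-≈ (Eq.sym (f-section x)) (mark⇒∈D (f x) x∈R)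
      ; ⇨-closed = λ {x} {y} x∉R x⇨y∈D → subst T (sym (proj₂ (pres-⇨ x y)))
          (from T-∧ ( T-residual⁺ {true} (⊥-elim ∘ x∉R) _
                    , ∈-resp-≈ (⇨-cong (f-section x) (f-section y)) x⇨y∈D ))
      }
      where
      open IsFilter D-filter
      open Marked using (elt; mark; mark⇒∈D)
      section : ∃ λ (f : HAHom A (markedAlgebra D-filter)) → ∀ x → x ≈ elt (proj₁ f x)
      section = zero-projective (markedAlgebra D-filter) A idHAHom (unmark D-filter)
                  (unmark-surjective D-filter) (unmark-reflects-⊥ D-filter)
      f : Carrier → Marked D-filter
      f = proj₁ (proj₁ section)
      f-hom : IsHAHom A (markedAlgebra D-filter) f
      f-hom = proj₂ (proj₁ section)
      f-section : ∀ x → x ≈ elt (f x)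
      f-section = proj₂ section
      open IsHAHom f-hom
      R : Carrier → Bool
      R = mark ∘ f

    module _ {K₁ K₂ K₃ : Carrier → Bool}
             (K₁-filter : IsFilter K₁) (K₂-filter : IsFilter K₂) (K₃-prime : IsPrimeFilter K₃) where
      private
        module K₁ = IsFilter K₁-filter
        module K₂ = IsFilter K₂-filter
        module K₃ = IsPrimeFilter K₃-prime
        module S = PrimeSubfilter (primeSubfilter (∩-isFilter K₁-filter K₂-filter))

      -- If some x ∈ K₃ escaped S, then x ⇨ (a ∨ b) would lie in K₁ ∩ K₂, hence in S ⊆ K₃,
      -- and modus ponens inside K₃ would put a ∨ b, and so a or b, into K₃.
      primeSubfilter-⊆⇒⊇ : K₁ ⊈ K₃ → K₂ ⊈ K₃ → S.R ⊆ K₃ → K₃ ⊆ S.R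
      primeSubfilter-⊆⇒⊇ (a , a∈K₁ , a∉K₃) (b , b∈K₂ , b∉K₃) S⊆K₃ {x} x∈K₃ =
        decidable-stable (T? (S.R x)) λ x∉S → [ a∉K₃ , b∉K₃ ]′ (K₃.∨-prime (a∨b∈K₃ x∉S))
        where
        x⇨a∨b∈K₁∩K₂ : x ⇨ (a ∨ b) ∈ K₁ ∩ K₂
        x⇨a∨b∈K₁∩K₂ = from T-∧ ( K₁.∈-mono (≤-trans (x≤x∨y a b) y≤x⇨y) a∈K₁
                               , K₂.∈-mono (≤-trans (y≤x∨y a b) y≤x⇨y) b∈K₂ )
        a∨b∈K₃ : x ∉ S.R → a ∨ b ∈ K₃
        a∨b∈K₃ x∉S = K₃.∈-mono ⇨-eval (K₃.∧-closed (S⊆K₃ (S.⇨-closed x∉S x⇨a∨b∈K₁∩K₂)) x∈K₃)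

      primeSubfilter-⊈ : Finite A → K₁ ⊈ K₃ → K₂ ⊈ K₃ → K₃ ⊈ K₁ → S.R ⊈ K₃
      primeSubfilter-⊈ finite K₁⊈K₃ K₂⊈K₃ K₃⊈K₁
        with ⊆-or-⊈ finite (IsFilter.∈-resp-≈ S.isFilter) K₃.∈-resp-≈
      ... | inj₂ S⊈K₃ = S⊈K₃
      ... | inj₁ S⊆K₃ = ⊥-elim (⊆⇒¬⊈ K₃⊆K₁ K₃⊈K₁)
        where
        K₃⊆K₁ : K₃ ⊆ K₁
        K₃⊆K₁ = ∩-⊆ˡ {K₁} {K₂} ∘ S.⊆D ∘ primeSubfilter-⊆⇒⊇ K₁⊈K₃ K₂⊈K₃ S⊆K₃

  record IncomparableTriple : Set (c ⊔ ℓ₂) where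
    field
      K₁ K₂ K₃ : Carrier → Bool
      K₁-prime : IsPrimeFilter K₁
      K₂-prime : IsPrimeFilter K₂
      K₃-prime : IsPrimeFilter K₃
      K₁⋈K₂    : Incomparable K₁ K₂
      K₁⋈K₃    : Incomparable K₁ K₃
      K₂⋈K₃    : Incomparable K₂ K₃

  module _ (finite : Finite A) (zero-projective : ZeroProjective c ℓ₁ ℓ₂ A) where

    module Descend (t : IncomparableTriple) where
      open IncomparableTriple t
      private
        F₁ : IsFilter K₁
        F₁ = IsPrimeFilter.isFilter K₁-prime
        F₂ : IsFilter K₂
        F₂ = IsPrimeFilter.isFilter K₂-prime
        F₃ : IsFilter K₃
        F₃ = IsPrimeFilter.isFilter K₃-prime
        module S₁₂ = PrimeSubfilter (primeSubfilter zero-projective (∩-isFilter F₁ F₂))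
        module S₁₃ = PrimeSubfilter (primeSubfilter zero-projective (∩-isFilter F₁ F₃))
        module S₂₃ = PrimeSubfilter (primeSubfilter zero-projective (∩-isFilter F₂ F₃))

        S₁₂⊈K₃ : S₁₂.R ⊈ K₃
        S₁₂⊈K₃ = primeSubfilter-⊈ zero-projective F₁ F₂ K₃-prime finite
                   (proj₁ K₁⋈K₃) (proj₁ K₂⋈K₃) (proj₂ K₁⋈K₃)
        S₁₃⊈K₂ : S₁₃.R ⊈ K₂
        S₁₃⊈K₂ = primeSubfilter-⊈ zero-projective F₁ F₃ K₂-prime finite
                   (proj₁ K₁⋈K₂) (proj₂ K₂⋈K₃) (proj₂ K₁⋈K₂)
        S₂₃⊈K₁ : S₂₃.R ⊈ K₁
        S₂₃⊈K₁ = primeSubfilter-⊈ zero-projective F₂ F₃ K₁-prime finite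
                   (proj₂ K₁⋈K₂) (proj₂ K₁⋈K₃) (proj₁ K₁⋈K₂)

        S₁₂⊆K₁ : S₁₂.R ⊆ K₁
        S₁₂⊆K₁ = ∩-⊆ˡ {K₁} {K₂} ∘ S₁₂.⊆D
        S₁₂⊆K₂ : S₁₂.R ⊆ K₂
        S₁₂⊆K₂ = ∩-⊆ʳ {K₁} {K₂} ∘ S₁₂.⊆D
        S₁₃⊆K₁ : S₁₃.R ⊆ K₁
        S₁₃⊆K₁ = ∩-⊆ˡ {K₁} {K₃} ∘ S₁₃.⊆D
        S₁₃⊆K₃ : S₁₃.R ⊆ K₃
        S₁₃⊆K₃ = ∩-⊆ʳ {K₁} {K₃} ∘ S₁₃.⊆D
        S₂₃⊆K₂ : S₂₃.R ⊆ K₂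
        S₂₃⊆K₂ = ∩-⊆ˡ {K₂} {K₃} ∘ S₂₃.⊆D
        S₂₃⊆K₃ : S₂₃.R ⊆ K₃
        S₂₃⊆K₃ = ∩-⊆ʳ {K₂} {K₃} ∘ S₂₃.⊆D

      triple : IncomparableTriple
      triple = record
        { K₁ = S₁₂.R ; K₂ = S₁₃.R ; K₃ = S₂₃.R
        ; K₁-prime = S₁₂.isPrimeFilter ; K₂-prime = S₁₃.isPrimeFilter ; K₃-prime = S₂₃.isPrimeFilter
        ; K₁⋈K₂ = ⊈-⊆ʳ S₁₂⊈K₃ S₁₃⊆K₃ , ⊈-⊆ʳ S₁₃⊈K₂ S₁₂⊆K₂
        ; K₁⋈K₃ = ⊈-⊆ʳ S₁₂⊈K₃ S₂₃⊆K₃ , ⊈-⊆ʳ S₂₃⊈K₁ S₁₂⊆K₁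
        ; K₂⋈K₃ = ⊈-⊆ʳ S₁₃⊈K₂ S₂₃⊆K₂ , ⊈-⊆ʳ S₂₃⊈K₁ S₁₃⊆K₁
        }

      size-< : size finite S₁₂.R < size finite K₁
      size-< = ⊂⇒size< finite S₁₂.∈-resp-≈ (IsFilter.∈-resp-≈ F₁) S₁₂⊆K₁ (⊈-⊆ʳ (proj₁ K₁⋈K₂) S₁₂⊆K₂)

    no-descent : (t : IncomparableTriple) → ¬ Acc _<_ (size finite (IncomparableTriple.K₁ t))
    no-descent t (acc smaller) = no-descent (Descend.triple t) (smaller (Descend.size-< t))

    incomparableTriple-impossible : ¬ IncomparableTriple
    incomparableTriple-impossible t = no-descent t (<-wellFounded _)

mainTheorem15 : ∀ {c ℓ₁ ℓ₂} (A : HeytingAlgebra c ℓ₁ ℓ₂) →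
    Finite A → ZeroProjective c ℓ₁ ℓ₂ A → AtMostTwoAtoms A
mainTheorem15 A finite zero-projective a b d a-atom b-atom d-atom
  with atoms-equal-or-incomparable A a-atom b-atom
     | atoms-equal-or-incomparable A a-atom d-atom
     | atoms-equal-or-incomparable A b-atom d-atom
... | inj₁ a≈b | _        | _        = inj₁ a≈b
... | inj₂ _   | inj₁ a≈d | _        = inj₂ (inj₁ a≈d)
... | inj₂ _   | inj₂ _   | inj₁ b≈d = inj₂ (inj₂ b≈d)
... | inj₂ a⋈b | inj₂ a⋈d | inj₂ b⋈d =
  ⊥-elim (incomparableTriple-impossible A finite zero-projective record
    { K₁ = ↑ A a-atom ; K₂ = ↑ A b-atom ; K₃ = ↑ A d-atom
    ; K₁-prime = ↑-isPrimeFilter A a-atom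
    ; K₂-prime = ↑-isPrimeFilter A b-atom
    ; K₃-prime = ↑-isPrimeFilter A d-atom
    ; K₁⋈K₂ = a⋈b ; K₁⋈K₃ = a⋈d ; K₂⋈K₃ = b⋈d
    })
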